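{- In both bijections $\phi^{(B)}_C:\sigma\mapsto\tau$ and $\phi^{(D)}_C:\sigma\mapsto\tau$, the labels on the rightmost path of $\tau$ is exactly the set of minimum entries of cycles of $|\sigma|$.
   Context: Signed cycle-up-down permutations: $\mathcal{CUD}^{(B)}_n$ consists of special signed permutations (cycles coming in pairs $(a_1,\dots,a_r)(\bar a_1,\dots,\bar a_r)$, written $(a_1,\dots,a_r)$) written as $(a_{1,1},a_{1,2},\ldots)\cdots(a_{m,1},\ldots)$ with all $a_{i,1}>0$ and $|\sigma|$ (absolute values of entries) cycle-up-down, i.e. in standard cycle notation (each cycle starts with its minimum, first entries increasing) every cycle satisfies $c_1<c_2>c_3<\cdots$. $\mathcal{CUD}^{(D)}_n$ consists of signed permutations $(a_{1,1},\ldots)\cdots(a_{m-1,1},\ldots)(a_{m,1},\overline{a_{m,1}})$ with no other cycle of the form $(a,\bar a)$, all $a_{i,1}>0$, and $|\sigma|$ cycle-up-down (reading the last cycle as $(a_{m,1})$). $\mathcal{T}_n$ is the set of complete (every non-leaf node has two children) plane binary trees with $n$ nodes labelled $1,\dots,n$, some leaves possibly unlabelled (empty), labels increasing along root-to-leaf paths. The rightmost path is $(v_1,\dots,v_d)$ with $v_1$ the root and $v_{i+1}$ the right child of $v_i$. $\mathcal{T}^\circ_n$ ($\mathcal{T}^*_n$) are the trees whose last node $v_d$ is empty (labelled). The bijections $\phi^{(B)}_C:\mathcal{CUD}^{(B)}_n\to\mathcal{T}^\circ_n$ and $\phi^{(D)}_C:\mathcal{CUD}^{(D)}_n\to\mathcal{T}^*_n$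 are built as follows. Algorithm 1 maps a sequence $\mathcal{A}$ of distinct integers to a non-plane complete increasing tree with empty leaves: if $\max\mathcal{A}$ is left of $\min\mathcal{A}$, replace $\mathcal{A}$ by its complement (the $i$-th smallest entry replaced by the $i$-th largest); write $\mathcal{A}=\mathcal{A}_L\,a_i\,\mathcal{A}_R$ with $a_i$ the minimum, make $a_i$ the root with children the trees of $\mathcal{A}_L,\mathcal{A}_R$ (empty node if empty), recursively. Algorithm 2 applies Algorithm 1 to $|a_{i,1}|,|a_{i,2}|,\dots$ for a cycle $C_i$ and then, for each entry: a node $|a_{i,j}|$ with two empty children loses them if $a_{i,j}<0$; a node with exactly one labelled child puts it on the right if $a_{i,j}<0$ and on the left if $a_{i,j}>0$; a node with two labelled children puts the smaller-labelled child on the right if $a_{i,j}<0$ and on the left if $a_{i,j}>0$. The resulting plane tree $\tau_i$ has root $a_{i,1}$ whose right child is empty. For $\phi^{(B)}_C$, trees $\tau_1,\dots,\tau_m$ are produced from all cycles; for $\phi^{(D)}_C$, $\tau_1,\dots,\tau_{m-1}$ from the first $m-1$ cycles and $\tau_m$ is a single node labelled $a_{m,1}$. Then the empty right child of the root of $\tau_i$ is replaced by $\tau_{i+1}$ for each $i$, giving $\tau$. -}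

module Defs where

open import Data.Bool using (Bool; true; false; if_then_else_; _∧_; _∨_; not)
open import Data.Nat using (ℕ; zero; suc; _<_; _≤_; _⊓_; _⊔_; _≡ᵇ_; _<ᵇ_)
open import Data.Integer using (ℤ; +_; -[1+_]; ∣_∣; 0ℤ) renaming (_<_ to _<ℤ_)
open import Data.List using (List; []; _∷_; _++_; map; concat; length; foldr; upTo)
open import Data.Bool.ListAction using (any)
open import Data.List.Relation.Unary.All using (All)
open import Data.List.Relation.Unary.Linked using (Linked)
open import Data.List.Relation.Binary.Permutation.Propositional using (_↭_)
open import Data.Product using (_×_; _,_)
open import Data.Unit using (⊤)
open import Data.Empty using (⊥)

data PTree : Set where
  empty : PTree
  lf    : ℕ → PTree
  nd    : ℕ → PTree → PTree → PTree

rightLabels : PTree → List ℕ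
rightLabels empty      = []
rightLabels (lf a)     = a ∷ []
rightLabels (nd a _ r) = a ∷ rightLabels r

minL : List ℕ → ℕ
minL []       = 0
minL (x ∷ xs) = foldr _⊓_ x xs

maxL : List ℕ → ℕ
maxL []       = 0
maxL (x ∷ xs) = foldr _⊔_ x xs

countB : (ℕ → Bool) → List ℕ → ℕ
countB p []       = 0
countB p (x ∷ xs) = if p x then suc (countB p xs) else countB p xs

maxLeftOfMinAux : ℕ → ℕ → List ℕ → Bool
maxLeftOfMinAux mx mn []       = false
maxLeftOfMinAux mx mn (x ∷ xs) =
  if x ≡ᵇ mn then false
  else (if x ≡ᵇ mx then true else maxLeftOfMinAux mx mn xs)

maxLeftOfMin : List ℕ → Bool
maxLeftOfMin xs = maxLeftOfMinAux (maxL xs) (minL xs) xs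

-- complement: the i-th smallest entry is replaced by the i-th largest,
-- i.e. x ↦ the entry y with #{z > y} = #{z < x}
complementEntry : List ℕ → ℕ → ℕ
complementEntry xs x = pick xs
  where
    r : ℕ
    r = countB (λ z → z <ᵇ x) xs
    pick : List ℕ → ℕ
    pick []       = x
    pick (y ∷ ys) = if countB (λ z → y <ᵇ z) xs ≡ᵇ r then y else pick ys

complementL : List ℕ → List ℕ
complementL xs = map (complementEntry xs) xs

splitAt≡ : ℕ → List ℕ → List ℕ × List ℕ
splitAt≡ m []       = [] , []
splitAt≡ m (x ∷ xs) with x ≡ᵇ m
... | true  = [] , xs
... | false with splitAt≡ m xs
...   | (l , r) = x ∷ l , r

-- Algorithm 1 (fuel = length of the sequence suffices; every recursive
-- call is on a strictly shorter sequence).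

alg1 : ℕ → List ℕ → PTree
alg1 _       []         = empty
alg1 zero    (_ ∷ _)    = empty
alg1 (suc f) xs@(_ ∷ _) with (if maxLeftOfMin xs then complementL xs else xs)
... | ys with splitAt≡ (minL ys) ys
...   | (l , r) = nd (minL ys) (alg1 f l) (alg1 f r)

algorithm1 : List ℕ → PTree
algorithm1 xs = alg1 (length xs) xs

isNegZ : ℤ → Bool
isNegZ (+ _)    = false
isNegZ -[1+ _ ] = true

negIn : List ℤ → ℕ → Bool
negIn c ℓ = any (λ x → (∣ x ∣ ≡ᵇ ℓ) ∧ isNegZ x) c

isLabelled : PTree → Bool
isLabelled empty = false
isLabelled _     = true

rootLabel : PTree → ℕ
rootLabel empty      = 0
rootLabel (lf a)     = a
rootLabel (nd a _ _) = a

fixNode : Bool → ℕ → PTree → PTree → PTree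
fixNode neg a l r with isLabelled l | isLabelled r
... | false | false = if neg then lf a else nd a empty empty
... | true  | false = if neg then nd a empty l else nd a l empty
... | false | true  = if neg then nd a empty r else nd a r empty
... | true  | true  =
  if rootLabel l <ᵇ rootLabel r
  then (if neg then nd a r l else nd a l r)
  else (if neg then nd a l r else nd a r l)

alg2 : (ℕ → Bool) → PTree → PTree
alg2 neg empty      = empty
alg2 neg (lf a)     = lf a
alg2 neg (nd a l r) = fixNode (neg a) a (alg2 neg l) (alg2 neg r)

cycleTree : List ℤ → PTree
cycleTree c = alg2 (negIn c) (algorithm1 (map ∣_∣ c))

graft : PTree → PTree → PTree
graft (nd a l _) t = nd a l t
graft s          _ = s

chain : List PTree → PTree
chain []           = empty
chain (t ∷ [])     = t
chain (t ∷ u ∷ ts) = graft t (chain (u ∷ ts))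

-- Signed cycle-up-down permutations, in the cycle notation used by the
-- paper: a list of cycles (a_{i,1}, a_{i,2}, ...), each signed cycle
-- standing for the pair (a_1..a_r)(ā_1..ā_r).

absCycles : List (List ℤ) → List (List ℕ)
absCycles = map (map ∣_∣)

StartsWithMin : List ℕ → Set
StartsWithMin []       = ⊥
StartsWithMin (x ∷ xs) = All (x <_) xs

mutual
  UpFrom : List ℕ → Set
  UpFrom []           = ⊤
  UpFrom (x ∷ [])     = ⊤
  UpFrom (x ∷ y ∷ zs) = (x < y) × DownFrom (y ∷ zs)

  DownFrom : List ℕ → Set
  DownFrom []           = ⊤
  DownFrom (x ∷ [])     = ⊤
  DownFrom (x ∷ y ∷ zs) = (y < x) × UpFrom (y ∷ zs)

UpDown : List ℕ → Set
UpDown = UpFrom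

FirstPositive : List ℤ → Set
FirstPositive []      = ⊥
FirstPositive (x ∷ _) = 0ℤ <ℤ x

headN : List ℕ → ℕ
headN []      = 0
headN (x ∷ _) = x

record IsCUDB (n : ℕ) (cs : List (List ℤ)) : Set where
  field
    isSignedPerm  : concat (absCycles cs) ↭ map suc (upTo n)
    firstPositive : All FirstPositive cs
    standardForm  : All StartsWithMin (absCycles cs)
    firstsIncr    : Linked _<_ (map headN (absCycles cs))
    upDown        : All UpDown (absCycles cs)

-- CUD^(D)_n: cycles cs followed by the last cycle (a, ā), which is read
-- as the one-cycle (a) of |σ| in all the conditions above.
IsCUDD : ℕ → List (List ℤ) → ℕ → Set
IsCUDD n cs a = IsCUDB n (cs ++ ((+ a) ∷ []) ∷ [])

φB : List (List ℤ) → PTree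
φB cs = chain (map cycleTree cs)

φD : List (List ℤ) → ℕ → PTree
φD cs a = chain (map cycleTree cs ++ lf a ∷ [])

absσB : List (List ℤ) → List (List ℕ)
absσB cs = absCycles cs

absσD : List (List ℤ) → ℕ → List (List ℕ)
absσD cs a = absCycles cs ++ (a ∷ []) ∷ []

cycleMinima : List (List ℕ) → List ℕ
cycleMinima = map minL

-- A cycle written in standard form starts with its minimum a, which is
-- positive. Algorithm 1 then makes a the root with an empty left subtree
-- (nothing precedes a), and Algorithm 2 keeps a unsigned, so it moves the
-- labelled subtree to the left: every τᵢ is a root labelled by the minimum
-- of its cycle with an empty right child. Grafting the τᵢ along their right
-- children therefore puts exactly these minima, in order, on the rightmost
-- path of τ (followed by the lone node a of the last cycle for type D).
module Submission where

open import Defs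
open import Data.Bool using (Bool; true; false)
open import Data.Nat using (ℕ; zero; suc; _≤_; _<_; _≡ᵇ_; s≤s)
open import Data.Nat.Properties using (m≥n⇒m⊓n≡n; <⇒≤)
open import Data.Integer using (ℤ; +_; -[1+_]; ∣_∣)
open import Data.List using (List; []; _∷_; _++_; [_]; map)
open import Data.List.Properties using (map-++; ++-identityʳ)
open import Data.List.Relation.Unary.All using (All; []; _∷_)
import Data.List.Relation.Unary.All as All
import Data.List.Relation.Unary.All.Properties as All
open import Data.List.Membership.Propositional using (_∈_)
open import Data.Product using (_×_; _,_; ∃; proj₁; proj₂)
open import Function.Bundles using (_⇔_; mk⇔)
open import Function.Base using (id; _∘_)
open import Relation.Binary.PropositionalEquality using (_≡_; refl; sym; trans; cong; subst; module ≡-Reasoning)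

≡ᵇ-refl : ∀ n → (n ≡ᵇ n) ≡ true
≡ᵇ-refl zero    = refl
≡ᵇ-refl (suc n) = ≡ᵇ-refl n

>⇒≡ᵇ-false : ∀ {m n} → m < n → (n ≡ᵇ m) ≡ false
>⇒≡ᵇ-false {zero}  {suc n} _         = refl
>⇒≡ᵇ-false {suc m} {suc n} (s≤s m<n) = >⇒≡ᵇ-false m<n

minL-head : ∀ {x} xs → All (x ≤_) xs → minL (x ∷ xs) ≡ x
minL-head []       []                = refl
minL-head (y ∷ ys) (x≤y ∷ x≤ys) rewrite minL-head ys x≤ys = m≥n⇒m⊓n≡n x≤y

maxLeftOfMin-headMin : ∀ {a} xs → All (a ≤_) xs → maxLeftOfMin (a ∷ xs) ≡ false
maxLeftOfMin-headMin {a} xs a≤xs rewrite minL-head xs a≤xs | ≡ᵇ-refl a = refl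

splitAt≡-head : ∀ a xs → splitAt≡ a (a ∷ xs) ≡ ([] , xs)
splitAt≡-head a xs rewrite ≡ᵇ-refl a = refl

alg1-headMin : ∀ f {a} xs → All (a ≤_) xs →
  alg1 (suc f) (a ∷ xs) ≡ nd a empty (alg1 f xs)
alg1-headMin f {a} xs a≤xs
  rewrite maxLeftOfMin-headMin xs a≤xs | minL-head xs a≤xs | splitAt≡-head a xs = refl

negIn-belowAll : ∀ {ℓ} c → All (ℓ <_) (map ∣_∣ c) → negIn c ℓ ≡ false
negIn-belowAll []      []             = refl
negIn-belowAll (x ∷ c) (ℓ<x ∷ ℓ<c) rewrite >⇒≡ᵇ-false ℓ<x = negIn-belowAll c ℓ<c

negIn-headMin : ∀ a c → All (a <_) (map ∣_∣ c) → negIn (+ a ∷ c) a ≡ false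
negIn-headMin a c a<c rewrite ≡ᵇ-refl a = negIn-belowAll c a<c

fixNode-unsigned-emptyLeft : ∀ a r → ∃ λ l → fixNode false a empty r ≡ nd a l empty
fixNode-unsigned-emptyLeft a r with isLabelled r
... | false = empty , refl
... | true  = r , refl

cycleTree-headMin : ∀ a c → All (a <_) (map ∣_∣ c) →
  ∃ λ l → cycleTree (+ a ∷ c) ≡ nd a l empty
cycleTree-headMin a c a<c = l , (begin
  cycleTree (+ a ∷ c)               ≡⟨ cong (alg2 neg) (alg1-headMin _ (map ∣_∣ c) (All.map <⇒≤ a<c)) ⟩
  fixNode (neg a) a empty r         ≡⟨ cong (λ b → fixNode b a empty r) (negIn-headMin a c a<c) ⟩
  fixNode false a empty r           ≡⟨ fixNode≡ ⟩
  nd a l empty                      ∎)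
  where
  open ≡-Reasoning
  neg : ℕ → Bool
  neg = negIn (+ a ∷ c)
  r : PTree
  r = alg2 neg (algorithm1 (map ∣_∣ c))
  l : PTree
  l = proj₁ (fixNode-unsigned-emptyLeft a r)
  fixNode≡ : fixNode false a empty r ≡ nd a l empty
  fixNode≡ = proj₂ (fixNode-unsigned-emptyLeft a r)

cycleTree-standard : ∀ c → FirstPositive c → StartsWithMin (map ∣_∣ c) →
  ∃ λ l → cycleTree c ≡ nd (minL (map ∣_∣ c)) l empty
cycleTree-standard []              ()
cycleTree-standard (-[1+ _ ] ∷ _)  ()
cycleTree-standard (+ a ∷ c)       _  a<c =
  subst (λ m → ∃ λ l → cycleTree (+ a ∷ c) ≡ nd m l empty)
        (sym (minL-head (map ∣_∣ c) (All.map <⇒≤ a<c)))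
        (cycleTree-headMin a c a<c)

rightLabels-chain-∷ : ∀ {t m l} us → t ≡ nd m l empty →
  rightLabels (chain (t ∷ us)) ≡ m ∷ rightLabels (chain us)
rightLabels-chain-∷ []      refl = refl
rightLabels-chain-∷ (_ ∷ _) refl = refl

rightLabels-chain-cycleTrees : ∀ cs ts → All FirstPositive cs → All StartsWithMin (absCycles cs) →
  rightLabels (chain (map cycleTree cs ++ ts)) ≡ cycleMinima (absCycles cs) ++ rightLabels (chain ts)
rightLabels-chain-cycleTrees []       ts []       []       = refl
rightLabels-chain-cycleTrees (c ∷ cs) ts (p ∷ ps) (q ∷ qs) =
  let (_ , τ≡) = cycleTree-standard c p q in
  trans (rightLabels-chain-∷ (map cycleTree cs ++ ts) τ≡)
        (cong (minL (map ∣_∣ c) ∷_) (rightLabels-chain-cycleTrees cs ts ps qs))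

rightLabels-φB : ∀ {n σ} → IsCUDB n σ → rightLabels (φB σ) ≡ cycleMinima (absσB σ)
rightLabels-φB {σ = σ} σ∈CUDB = begin
  rightLabels (chain (map cycleTree σ))        ≡⟨ cong (rightLabels ∘ chain) (++-identityʳ (map cycleTree σ)) ⟨
  rightLabels (chain (map cycleTree σ ++ []))  ≡⟨ rightLabels-chain-cycleTrees σ [] firstPositive standardForm ⟩
  cycleMinima (absCycles σ) ++ []              ≡⟨ ++-identityʳ _ ⟩
  cycleMinima (absCycles σ)                    ∎
  where open ≡-Reasoning; open IsCUDB σ∈CUDB

rightLabels-φD : ∀ {n σ a} → IsCUDD n σ a → rightLabels (φD σ a) ≡ cycleMinima (absσD σ a)
rightLabels-φD {σ = σ} {a} σ∈CUDD = begin
  rightLabels (chain (map cycleTree σ ++ [ lf a ]))  ≡⟨ rightLabels-chain-cycleTrees σ [ lf a ] σ-firstPositive σ-standardForm ⟩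
  cycleMinima (absCycles σ) ++ [ a ]                 ≡⟨ map-++ minL (absCycles σ) [ [ a ] ] ⟨
  cycleMinima (absCycles σ ++ [ [ a ] ])             ∎
  where
  open ≡-Reasoning
  open IsCUDB σ∈CUDD
  σ-firstPositive : All FirstPositive σ
  σ-firstPositive = All.++⁻ˡ σ firstPositive
  σ-standardForm : All StartsWithMin (absCycles σ)
  σ-standardForm = All.map⁺ (All.++⁻ˡ σ (All.map⁻ standardForm))

≡⇒∈⇔ : ∀ {A : Set} {xs ys : List A} → xs ≡ ys → ∀ x → (x ∈ xs) ⇔ (x ∈ ys)
≡⇒∈⇔ refl _ = mk⇔ id id

corollary5p4 :
    ((n : ℕ) (σ : List (List ℤ)) → IsCUDB n σ →
       (x : ℕ) → (x ∈ rightLabels (φB σ)) ⇔ (x ∈ cycleMinima (absσB σ)))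
    ×
    ((n : ℕ) (σ : List (List ℤ)) (a : ℕ) → IsCUDD n σ a →
       (x : ℕ) → (x ∈ rightLabels (φD σ a)) ⇔ (x ∈ cycleMinima (absσD σ a)))
corollary5p4 =
  (λ _ _ σ∈CUDB → ≡⇒∈⇔ (rightLabels-φB σ∈CUDB)) ,
  (λ _ _ _ σ∈CUDD → ≡⇒∈⇔ (rightLabels-φD σ∈CUDD))
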